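{- Let $F$ be a finite field of characteristic $p$ and order $q>4$ with $[F:\mathbb{F}_p]=2^s$ for some $s\ge1$, and let $K$ be the subfield of $F$ of order $\sqrt q$. Then there is a positive integer $d$ with $\gcd(d,q-1)=1$ such that $d$ is nondegenerate over $F$ but degenerate over $K$. Examples of such $d$ are: $d=q-\sqrt q+1$ when $\sqrt q\bmod 3\in\{0,1\}$; $d=(q+2)/3$ when $\sqrt q\bmod 9\in\{2,8\}$; and $d=(2q+1)/3$ when $\sqrt q\bmod 9\in\{5,8\}$.
   Context: For a subfield $E$ of $F$, a positive integer $d$ is degenerate over $E$ if $d$ is congruent to a power of $p$ modulo $|E|-1$, and nondegenerate over $E$ otherwise. -}

module Defs where

open import Data.Nat using (ℕ; _^_; _∸_; _<_)
open import Data.Nat.Coprimality using (Coprime)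
open import Data.Integer using (ℤ; +_; _-_)
open import Data.Integer.Divisibility using (_∣_)
open import Data.Product using (∃; _×_)
open import Relation.Nullary using (¬_)

_≡_[mod_] : ℕ → ℕ → ℕ → Set
a ≡ b [mod m ] = (+ m) ∣ ((+ a) - (+ b))

-- d is degenerate over a subfield E of order e (of a field of characteristic p):
-- d is congruent to a power of p modulo e - 1.
Degenerate : (p e d : ℕ) → Set
Degenerate p e d = ∃ λ k → d ≡ p ^ k [mod (e ∸ 1) ]

Nondegenerate : (p e d : ℕ) → Set
Nondegenerate p e d = ¬ Degenerate p e d

Good : (p q r d : ℕ) → Set
Good p q r d = (0 < d) × Coprime d (q ∸ 1) × Nondegenerate p q d × Degenerate p r d

module Submission where

-- Let F have order q = p ^ n with n = 2 ^ s ≥ 2, and K its subfield of order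
-- r = p ^ (2 ^ (s - 1)), so that q = r * r, p ∣ r and (as q > 4) r ≥ 3.
-- Each of the three candidates d = r² − r + 1, (r² + 2)/3, (2r² + 1)/3 is
-- written as d = 1 + (r − 1) c, which makes it degenerate over K (d ≡ p⁰).
-- For nondegeneracy over F we use that p ^ n ≡ 1 modulo q − 1: every power of
-- p is congruent to some p ^ j < q − 1 with j < n, so a d < q − 1 that is not a
-- power of p cannot be congruent to one (lemma nondegenerate).  Coprimality
-- with q − 1 follows because any common divisor divides 3, while the residue
-- conditions modulo 3 resp. 9 rule out 3.  The file first develops these
-- general facts (congruences and remainders, powers of p, small divisors),
-- then treats the three cases with r = 3 + u resp. r = 5 + 3m, and finally
-- notes that every residue of r modulo 9 falls under one of the cases.

open import Defs
open import Data.Nat using (ℕ; _^_; _∸_; _+_; _*_; _<_; _≤_; _/_; _%_)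
open import Data.Nat.Primality using (Prime)
open import Data.Product using (∃; _×_)
open import Data.Sum using (_⊎_)
open import Relation.Binary.PropositionalEquality using (_≡_)

open import Data.Nat using (zero; suc; z≤n; s≤s; NonZero; >-nonZero; nonTrivial⇒n>1)
open import Data.Nat.Properties
open import Data.Nat.DivMod
  using (m≡m%n+[m/n]*n; [m+n]%n≡m%n; [m+kn]%n≡m%n; m%n<n; m<n⇒m%n≡m; m*n/n≡m;
         %-distribˡ-*; %-remove-+ʳ; m∣n⇒o%n%m≡o%m)
open import Data.Nat.Divisibility
  using (_∣_; divides; ∣-refl; ∣-trans; ∣⇒≤; ∣1⇒≡1; ∣m+n∣m⇒∣n; m∣m*n; ∣m⇒∣m*n; ∣n⇒∣m*n;
         *-pres-∣; n∣m⇒m%n≡0)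
open import Data.Nat.Primality using (prime?; prime⇒irreducible; prime⇒nonTrivial)
open import Data.Nat.Coprimality using (Coprime)
open import Data.Nat.Tactic.RingSolver using (solve-∀)
open import Data.Integer as ℤ using (+_)
import Data.Integer.Properties as ℤ
open import Data.Product using (_,_)
open import Data.Sum using (inj₁; inj₂; [_,_]′)
open import Data.Empty using (⊥-elim)
open import Relation.Nullary using (¬_; contradiction)
open import Relation.Nullary.Decidable using (from-yes)
open import Relation.Binary.PropositionalEquality using (_≢_; refl; sym; trans; cong; subst; module ≡-Reasoning)

%-≡-of-∣∸ : ∀ {a b Q} .{{_ : NonZero Q}} → b ≤ a → Q ∣ a ∸ b → a % Q ≡ b % Q
%-≡-of-∣∸ {a} {b} {Q} b≤a Q∣a∸b = begin
  a % Q             ≡⟨ cong (_% Q) (sym (m+[n∸m]≡n b≤a)) ⟩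
  (b + (a ∸ b)) % Q ≡⟨ %-remove-+ʳ b Q∣a∸b ⟩
  b % Q             ∎
  where open ≡-Reasoning

≡-mod⇒%≡ : ∀ {a b Q} .{{_ : NonZero Q}} → a ≡ b [mod Q ] → a % Q ≡ b % Q
≡-mod⇒%≡ {a} {b} {Q} Q∣a-b with ≤-total b a
... | inj₁ b≤a = %-≡-of-∣∸ b≤a (subst (Q ∣_) ∣a-b∣≡a∸b Q∣a-b)
  where
  ∣a-b∣≡a∸b : ℤ.∣ + a ℤ.- + b ∣ ≡ a ∸ b
  ∣a-b∣≡a∸b = trans (cong ℤ.∣_∣ (ℤ.m-n≡m⊖n a b)) (trans (ℤ.∣m⊖n∣≡∣n⊖m∣ a b) (ℤ.∣⊖∣-≤ b≤a))
... | inj₂ a≤b = sym (%-≡-of-∣∸ a≤b (subst (Q ∣_) ∣a-b∣≡b∸a Q∣a-b))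
  where
  ∣a-b∣≡b∸a : ℤ.∣ + a ℤ.- + b ∣ ≡ b ∸ a
  ∣a-b∣≡b∸a = trans (cong ℤ.∣_∣ (ℤ.m-n≡m⊖n a b)) (ℤ.∣⊖∣-≤ a≤b)

^-%-periodic : ∀ {p n Q} .{{_ : NonZero Q}} → p ^ n % Q ≡ 1 % Q →
  ∀ j m → p ^ (j + m * n) % Q ≡ p ^ j % Q
^-%-periodic {p} {n} {Q} pⁿ≡1 j zero = cong (λ e → p ^ e % Q) (+-identityʳ j)
^-%-periodic {p} {n} {Q} pⁿ≡1 j (suc m) = begin
  p ^ (j + (n + m * n)) % Q         ≡⟨ cong (λ e → p ^ e % Q) (shift j n (m * n)) ⟩
  p ^ (j + m * n + n) % Q           ≡⟨ cong (_% Q) (^-distribˡ-+-* p (j + m * n) n) ⟩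
  (X * p ^ n) % Q                   ≡⟨ %-distribˡ-* X (p ^ n) Q ⟩
  ((X % Q) * (p ^ n % Q)) % Q       ≡⟨ cong (λ y → ((X % Q) * y) % Q) pⁿ≡1 ⟩
  ((X % Q) * (1 % Q)) % Q           ≡⟨ %-distribˡ-* X 1 Q ⟨
  (X * 1) % Q                       ≡⟨ cong (_% Q) (*-identityʳ X) ⟩
  X % Q                             ≡⟨ ^-%-periodic pⁿ≡1 j m ⟩
  p ^ j % Q                         ∎
  where
  open ≡-Reasoning
  X = p ^ (j + m * n)
  shift : ∀ j n k → j + (n + k) ≡ j + k + n
  shift = solve-∀

^-<-pred-^ : ∀ {p n j} → 2 ≤ p → 2 ≤ n → j < n → p ^ j < p ^ n ∸ 1
^-<-pred-^ {p@(suc _)} {suc n} {j} 2≤p (s≤s 1≤n) (s≤s j≤n) =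
  m+n≤o⇒m≤o∸n (suc (p ^ j)) (begin
    suc (p ^ j) + 1      ≡⟨ +-comm (suc (p ^ j)) 1 ⟩
    2 + p ^ j            ≤⟨ +-mono-≤ 2≤pⁿ (^-monoʳ-≤ p j≤n) ⟩
    p ^ n + p ^ n        ≡⟨ cong (λ x → p ^ n + x) (+-identityʳ (p ^ n)) ⟨
    2 * p ^ n            ≤⟨ *-monoˡ-≤ (p ^ n) 2≤p ⟩
    p * p ^ n            ∎)
  where
  open ≤-Reasoning
  2≤pⁿ : 2 ≤ p ^ n
  2≤pⁿ = ≤-trans 2≤p (≤-trans (≤-reflexive (sym (*-identityʳ p))) (^-monoʳ-≤ p 1≤n))

-- Nondegeneracy over a field of order q = p ^ n (n ≥ 2): every d < q ∸ 1 that
-- is not a power of p.  A congruence d ≡ p ^ k reduces, by periodicity, to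
-- d ≡ p ^ (k % n), and both sides lie below the modulus.
nondegenerate : ∀ {p n q d} → 2 ≤ p → 2 ≤ n → q ≡ p ^ n → d < q ∸ 1 →
  (∀ k → d ≢ p ^ k) → Nondegenerate p q d
nondegenerate {p@(suc _)} {n@(suc _)} {d = d} 2≤p 2≤n refl d<Q notPower (k , d≡pᵏ) =
  notPower (k % n) d≡pʲ
  where
  open ≡-Reasoning
  Q = p ^ n ∸ 1
  instance
    Q≢0 : NonZero Q
    Q≢0 = >-nonZero (≤-<-trans z≤n d<Q)
  pⁿ≡1 : p ^ n % Q ≡ 1 % Q
  pⁿ≡1 = trans (cong (_% Q) (sym (m+[n∸m]≡n (m^n>0 p n)))) ([m+n]%n≡m%n 1 Q)
  d≡pʲ : d ≡ p ^ (k % n)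
  d≡pʲ = begin
    d                              ≡⟨ m<n⇒m%n≡m d<Q ⟨
    d % Q                          ≡⟨ ≡-mod⇒%≡ d≡pᵏ ⟩
    p ^ k % Q                      ≡⟨ cong (λ e → p ^ e % Q) (m≡m%n+[m/n]*n k n) ⟩
    p ^ (k % n + (k / n) * n) % Q  ≡⟨ ^-%-periodic pⁿ≡1 (k % n) (k / n) ⟩
    p ^ (k % n) % Q                ≡⟨ m<n⇒m%n≡m (^-<-pred-^ 2≤p 2≤n (m%n<n k n)) ⟩
    p ^ (k % n)                    ∎

-- Sufficient conditions for Good; d = 1 + (r ∸ 1) c is degenerate over K
-- because it is congruent to p ^ 0 modulo r ∸ 1.
good-criterion : ∀ {p n q r d} c → 2 ≤ p → 2 ≤ n → q ≡ p ^ n →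
  d ≡ suc ((r ∸ 1) * c) → d < q ∸ 1 → Coprime d (q ∸ 1) → (∀ k → d ≢ p ^ k) →
  Good p q r d
good-criterion {r = r} c 2≤p 2≤n q≡pⁿ refl d<Q coprime notPower =
  s≤s z≤n , coprime , nondegenerate 2≤p 2≤n q≡pⁿ d<Q notPower , (0 , divides c (*-comm (r ∸ 1) c))

not-a-power : ∀ {p d} → d ≢ 1 → d ≢ p → ¬ (p * p ∣ d) → ∀ k → d ≢ p ^ k
not-a-power d≢1 d≢p p²∤d zero = d≢1
not-a-power {p} d≢1 d≢p p²∤d (suc zero) d≡p¹ = d≢p (trans d≡p¹ (*-identityʳ p))
not-a-power {p} d≢1 d≢p p²∤d (suc (suc k)) refl =
  p²∤d (subst (p * p ∣_) (*-assoc p p (p ^ k)) (m∣m*n (p ^ k)))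

not-a-power-of-¬∣ : ∀ {p d} → d ≢ 1 → ¬ (p ∣ d) → ∀ k → d ≢ p ^ k
not-a-power-of-¬∣ {p} d≢1 p∤d =
  not-a-power d≢1 (λ { refl → p∤d ∣-refl }) (λ p²∣d → p∤d (∣-trans (m∣m*n p) p²∣d))

¬∣-suc : ∀ {p a} → 2 ≤ p → p ∣ a → ¬ (p ∣ suc a)
¬∣-suc {p} {a} (s≤s (s≤s _)) p∣a p∣1+a
  with ∣1⇒≡1 (∣m+n∣m⇒∣n (subst (p ∣_) (+-comm 1 a) p∣1+a) p∣a)
... | ()

divisor-of-3 : ∀ {i y} → i ∣ 3 → i ∣ y → ¬ (3 ∣ y) → i ≡ 1
divisor-of-3 i∣3 i∣y 3∤y with prime⇒irreducible (from-yes (prime? 3)) i∣3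
... | inj₁ i≡1 = i≡1
... | inj₂ refl = ⊥-elim (3∤y i∣y)

-- If Q = d + t and d = t y + 3 with 3 ∤ t, a common divisor of d and Q
-- divides t and then 3, so d and Q are coprime.
coprime-by-difference : ∀ {d Q t y} → Q ≡ d + t → d ≡ t * y + 3 → ¬ (3 ∣ t) → Coprime d Q
coprime-by-difference {t = t} {y} refl refl 3∤t {i} (i∣d , i∣Q) = divisor-of-3 i∣3 i∣t 3∤t
  where
  i∣t : i ∣ t
  i∣t = ∣m+n∣m⇒∣n i∣Q i∣d
  i∣3 : i ∣ 3
  i∣3 = ∣m+n∣m⇒∣n i∣d (∣m⇒∣m*n y i∣t)

coprime-by-thirds : ∀ {d Q} a → d * 3 ≡ a * Q + 3 → ¬ (3 ∣ d) → Coprime d Q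
coprime-by-thirds {d} {Q} a 3d≡ 3∤d {i} (i∣d , i∣Q) = divisor-of-3 i∣3 i∣d 3∤d
  where
  i∣3 : i ∣ 3
  i∣3 = ∣m+n∣m⇒∣n (subst (i ∣_) 3d≡ (∣m⇒∣m*n 3 i∣d)) (∣n⇒∣m*n a i∣Q)

¬3∣-of-thirds : ∀ {d x} → d * 3 ≡ x → x % 9 ≢ 0 → ¬ (3 ∣ d)
¬3∣-of-thirds {d} refl x%9≢0 3∣d = x%9≢0 (n∣m⇒m%n≡0 (d * 3) 9 (*-pres-∣ 3∣d (∣-refl {3})))

quadratic-% : ∀ a c r n .{{_ : NonZero n}} →
  (a * (r * r) + c) % n ≡ (a * ((r % n) * (r % n)) + c) % n
quadratic-% a c r n = begin
  (a * (r * r) + c) % n                               ≡⟨ cong (λ x → (a * (x * x) + c) % n) (m≡m%n+[m/n]*n r n) ⟩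
  (a * ((t + u * n) * (t + u * n)) + c) % n           ≡⟨ cong (_% n) (expand a c t u n) ⟩
  (a * (t * t) + c + a * (2 * t * u + u * u * n) * n) % n ≡⟨ [m+kn]%n≡m%n (a * (t * t) + c) (a * (2 * t * u + u * u * n)) n ⟩
  (a * (t * t) + c) % n                               ∎
  where
  open ≡-Reasoning
  t = r % n
  u = r / n
  expand : ∀ a c t u n → a * ((t + u * n) * (t + u * n)) + c ≡ a * (t * t) + c + a * (2 * t * u + u * u * n) * n
  expand = solve-∀

mod-3-of-mod-9 : ∀ r {e} → r % 9 ≡ e → r % 3 ≡ e % 3
mod-3-of-mod-9 r r≡e = trans (sym (m∣n⇒o%n%m≡o%m 3 9 r (divides 3 refl))) (cong (_% 3) r≡e)

¬3∣-pred² : ∀ t → (2 + t) % 3 ≡ 0 ⊎ (2 + t) % 3 ≡ 1 → ¬ (3 ∣ t)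
¬3∣-pred² t (inj₁ r%3≡0) 3∣t with trans (sym (%-remove-+ʳ 2 3∣t)) r%3≡0
... | ()
¬3∣-pred² t (inj₂ r%3≡1) 3∣t with trans (sym (%-remove-+ʳ 2 3∣t)) r%3≡1
... | ()

five-plus-3m : ∀ {r} → 3 ≤ r → r % 3 ≡ 2 → ∃ λ m → r ≡ 5 + m * 3
five-plus-3m {r} 3≤r r%3≡2 with r / 3 | m≡m%n+[m/n]*n r 3
... | zero  | r≡ = contradiction (subst (3 ≤_) (trans r≡ (cong (_+ 0) r%3≡2)) 3≤r) λ { (s≤s (s≤s ())) }
... | suc m | r≡ = m , trans r≡ (cong (_+ suc m * 3) r%3≡2)

square-pred : ∀ s → suc s * suc s ∸ 1 ≡ s * (s + 2)
square-pred s = expand s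
  where
  expand : ∀ s → s + s * (1 + s) ≡ s * (s + 2)
  expand = solve-∀

-- Case r ≡ 0, 1 (mod 3), writing r = 3 + u: d = r² − r + 1 = 1 + (r − 1) r.
-- Here q − 1 = d + (r − 2) and d = (r − 2)(r + 1) + 3 with 3 ∤ r − 2, and d ≡ 1 (mod p).
case-A : ∀ {p n r} → 2 ≤ p → 2 ≤ n → r * r ≡ p ^ n → p ∣ r → 3 ≤ r →
  r % 3 ≡ 0 ⊎ r % 3 ≡ 1 → Good p (r * r) r (r * r ∸ r + 1)
case-A {p} {r = r@(suc (suc (suc u)))} 2≤p 2≤n r²≡pⁿ p∣r (s≤s (s≤s (s≤s _))) r%3 =
  subst (Good p (r * r) r) (sym d≡)
    (good-criterion {r = r} r 2≤p 2≤n r²≡pⁿ refl d<Q coprime (not-a-power-of-¬∣ (λ ()) p∤d))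
  where
  d = suc ((2 + u) * r)
  d≡ : r * r ∸ r + 1 ≡ d
  d≡ = trans (cong (_+ 1) (m+n∸m≡n r ((2 + u) * r))) (+-comm _ 1)
  ring-Q : ∀ u → (2 + u) * ((2 + u) + 2) ≡ suc ((2 + u) * (3 + u)) + (1 + u)
  ring-Q = solve-∀
  ring-d : ∀ u → suc ((2 + u) * (3 + u)) ≡ (1 + u) * (4 + u) + 3
  ring-d = solve-∀
  Q≡ : r * r ∸ 1 ≡ d + (1 + u)
  Q≡ = trans (square-pred (2 + u)) (ring-Q u)
  d<Q : d < r * r ∸ 1
  d<Q = subst (d <_) (sym Q≡) (m<m+n d (s≤s z≤n))
  coprime : Coprime d (r * r ∸ 1)
  coprime = subst (Coprime d) (sym Q≡) (coprime-by-difference {y = 4 + u} refl (ring-d u) (¬3∣-pred² (1 + u) r%3))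
  p∤d : ¬ (p ∣ d)
  p∤d = ¬∣-suc 2≤p (∣n⇒∣m*n (2 + u) p∣r)

r²+2≢0-mod-9 : ∀ r → r % 9 ≡ 2 ⊎ r % 9 ≡ 8 → (r * r + 2) % 9 ≢ 0
r²+2≢0-mod-9 r h ≡0 =
  by-residue h (trans (sym (quadratic-% 1 2 r 9)) (trans (cong (λ x → (x + 2) % 9) (*-identityˡ (r * r))) ≡0))
  where
  by-residue : r % 9 ≡ 2 ⊎ r % 9 ≡ 8 → (1 * ((r % 9) * (r % 9)) + 2) % 9 ≢ 0
  by-residue (inj₁ r≡2) rewrite r≡2 = λ ()
  by-residue (inj₂ r≡8) rewrite r≡8 = λ ()

2r²+1≢0-mod-9 : ∀ r → r % 9 ≡ 5 ⊎ r % 9 ≡ 8 → (2 * (r * r) + 1) % 9 ≢ 0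
2r²+1≢0-mod-9 r h ≡0 = by-residue h (trans (sym (quadratic-% 2 1 r 9)) ≡0)
  where
  by-residue : r % 9 ≡ 5 ⊎ r % 9 ≡ 8 → (2 * ((r % 9) * (r % 9)) + 1) % 9 ≢ 0
  by-residue (inj₁ r≡5) rewrite r≡5 = λ ()
  by-residue (inj₂ r≡8) rewrite r≡8 = λ ()

-- Case r ≡ 2, 8 (mod 9), writing r = 5 + 3m: d = (r² + 2)/3 = 9 + 10m + 3m²
-- = 1 + (r − 1)(m + 2), and 3 d = (q − 1) + 3 with 3 ∤ d.  Moreover d > r ≥ p
-- and p * p ∤ d because p * p ∣ r² but p * p ∤ 2.
case-B : ∀ {p n r} → 2 ≤ p → 2 ≤ n → r * r ≡ p ^ n → p ∣ r → 3 ≤ r →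
  r % 9 ≡ 2 ⊎ r % 9 ≡ 8 → Good p (r * r) r ((r * r + 2) / 3)
case-B {p} {r = r} 2≤p 2≤n r²≡pⁿ p∣r 3≤r r%9
  with five-plus-3m 3≤r ([ mod-3-of-mod-9 r , mod-3-of-mod-9 r ]′ r%9)
... | m , refl = subst (Good p (r * r) r) (sym d≡)
    (good-criterion {r = r} (2 + m) 2≤p 2≤n r²≡pⁿ (ring-deg m) d<Q coprime (not-a-power (λ ()) d≢p p²∤d))
  where
  d = 9 + m * 10 + m * m * 3
  ring-3d : ∀ m → (9 + m * 10 + m * m * 3) * 3 ≡ (5 + m * 3) * (5 + m * 3) + 2
  ring-3d = solve-∀
  ring-deg : ∀ m → 9 + m * 10 + m * m * 3 ≡ suc ((4 + m * 3) * (2 + m))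
  ring-deg = solve-∀
  ring-Q : ∀ m → (4 + m * 3) * ((4 + m * 3) + 2) ≡ suc (9 + m * 10 + m * m * 3) + (14 + m * 20 + m * m * 6)
  ring-Q = solve-∀
  ring-thirds : ∀ m → (9 + m * 10 + m * m * 3) * 3 ≡ 1 * ((4 + m * 3) * ((4 + m * 3) + 2)) + 3
  ring-thirds = solve-∀
  ring-r<d : ∀ m → 9 + m * 10 + m * m * 3 ≡ suc ((5 + m * 3) + (3 + m * 7 + m * m * 3))
  ring-r<d = solve-∀
  d≡ : (r * r + 2) / 3 ≡ d
  d≡ = trans (cong (_/ 3) (sym (ring-3d m))) (m*n/n≡m d 3)
  Q≡ : r * r ∸ 1 ≡ (4 + m * 3) * ((4 + m * 3) + 2)
  Q≡ = square-pred (4 + m * 3)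
  d<Q : d < r * r ∸ 1
  d<Q = subst (d <_) (sym (trans Q≡ (ring-Q m))) (m≤m+n (suc d) _)
  coprime : Coprime d (r * r ∸ 1)
  coprime = subst (Coprime d) (sym Q≡)
    (coprime-by-thirds 1 (ring-thirds m) (¬3∣-of-thirds (ring-3d m) (r²+2≢0-mod-9 r r%9)))
  r<d : r < d
  r<d = subst (r <_) (sym (ring-r<d m)) (s≤s (m≤m+n r _))
  d≢p : d ≢ p
  d≢p d≡p = <⇒≱ r<d (subst (_≤ r) (sym d≡p) (∣⇒≤ p∣r))
  p²∤d : ¬ (p * p ∣ d)
  p²∤d p²∣d = contradiction (≤-trans (*-mono-≤ 2≤p 2≤p) (∣⇒≤ p²∣2)) λ { (s≤s (s≤s ())) }
    where
    p²∣2 : p * p ∣ 2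
    p²∣2 = ∣m+n∣m⇒∣n (subst (p * p ∣_) (ring-3d m) (∣m⇒∣m*n 3 p²∣d)) (*-pres-∣ p∣r p∣r)

-- Case r ≡ 5, 8 (mod 9), writing r = 5 + 3m: d = (2r² + 1)/3 = 17 + 20m + 6m²
-- = 1 + (r − 1)(2m + 4), and 3 d = 2 (q − 1) + 3 with 3 ∤ d; also 3 d ≡ 1 (mod p).
case-C : ∀ {p n r} → 2 ≤ p → 2 ≤ n → r * r ≡ p ^ n → p ∣ r → 3 ≤ r →
  r % 9 ≡ 5 ⊎ r % 9 ≡ 8 → Good p (r * r) r ((2 * (r * r) + 1) / 3)
case-C {p} {r = r} 2≤p 2≤n r²≡pⁿ p∣r 3≤r r%9
  with five-plus-3m 3≤r ([ mod-3-of-mod-9 r , mod-3-of-mod-9 r ]′ r%9)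
... | m , refl = subst (Good p (r * r) r) (sym d≡)
    (good-criterion {r = r} (4 + m * 2) 2≤p 2≤n r²≡pⁿ (ring-deg m) d<Q coprime (not-a-power-of-¬∣ (λ ()) p∤d))
  where
  d = 17 + m * 20 + m * m * 6
  ring-3d : ∀ m → (17 + m * 20 + m * m * 6) * 3 ≡ 2 * ((5 + m * 3) * (5 + m * 3)) + 1
  ring-3d = solve-∀
  ring-deg : ∀ m → 17 + m * 20 + m * m * 6 ≡ suc ((4 + m * 3) * (4 + m * 2))
  ring-deg = solve-∀
  ring-Q : ∀ m → (4 + m * 3) * ((4 + m * 3) + 2) ≡ suc (17 + m * 20 + m * m * 6) + (6 + m * 10 + m * m * 3)
  ring-Q = solve-∀
  ring-thirds : ∀ m → (17 + m * 20 + m * m * 6) * 3 ≡ 2 * ((4 + m * 3) * ((4 + m * 3) + 2)) + 3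
  ring-thirds = solve-∀
  d≡ : (2 * (r * r) + 1) / 3 ≡ d
  d≡ = trans (cong (_/ 3) (sym (ring-3d m))) (m*n/n≡m d 3)
  Q≡ : r * r ∸ 1 ≡ (4 + m * 3) * ((4 + m * 3) + 2)
  Q≡ = square-pred (4 + m * 3)
  d<Q : d < r * r ∸ 1
  d<Q = subst (d <_) (sym (trans Q≡ (ring-Q m))) (m≤m+n (suc d) _)
  coprime : Coprime d (r * r ∸ 1)
  coprime = subst (Coprime d) (sym Q≡)
    (coprime-by-thirds 2 (ring-thirds m) (¬3∣-of-thirds (ring-3d m) (2r²+1≢0-mod-9 r r%9)))
  p∤d : ¬ (p ∣ d)
  p∤d p∣d = ¬∣-suc 2≤p (∣n⇒∣m*n 2 (∣m⇒∣m*n r p∣r)) p∣1+2r²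
    where
    p∣1+2r² : p ∣ 1 + 2 * (r * r)
    p∣1+2r² = subst (p ∣_) (trans (ring-3d m) (+-comm _ 1)) (∣m⇒∣m*n {m = d} 3 p∣d)

residue-cases-below-9 : ∀ e → e < 9 → (e % 3 ≡ 0 ⊎ e % 3 ≡ 1) ⊎ (e ≡ 2 ⊎ e ≡ 8) ⊎ (e ≡ 5 ⊎ e ≡ 8)
residue-cases-below-9 0 _ = inj₁ (inj₁ refl)
residue-cases-below-9 1 _ = inj₁ (inj₂ refl)
residue-cases-below-9 2 _ = inj₂ (inj₁ (inj₁ refl))
residue-cases-below-9 3 _ = inj₁ (inj₁ refl)
residue-cases-below-9 4 _ = inj₁ (inj₂ refl)
residue-cases-below-9 5 _ = inj₂ (inj₂ (inj₁ refl))
residue-cases-below-9 6 _ = inj₁ (inj₁ refl)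
residue-cases-below-9 7 _ = inj₁ (inj₂ refl)
residue-cases-below-9 8 _ = inj₂ (inj₁ (inj₂ refl))
residue-cases-below-9 (suc (suc (suc (suc (suc (suc (suc (suc (suc _))))))))) (s≤s (s≤s (s≤s (s≤s (s≤s (s≤s (s≤s (s≤s (s≤s ())))))))))

residue-cases : ∀ r → (r % 3 ≡ 0 ⊎ r % 3 ≡ 1) ⊎ (r % 9 ≡ 2 ⊎ r % 9 ≡ 8) ⊎ (r % 9 ≡ 5 ⊎ r % 9 ≡ 8)
residue-cases r with residue-cases-below-9 (r % 9) (m%n<n r 9)
... | inj₁ (inj₁ e%3≡0) = inj₁ (inj₁ (trans (mod-3-of-mod-9 r refl) e%3≡0))
... | inj₁ (inj₂ e%3≡1) = inj₁ (inj₂ (trans (mod-3-of-mod-9 r refl) e%3≡1))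
... | inj₂ r%9 = inj₂ r%9

theorem-for-squares : ∀ {p n q r} → 2 ≤ p → 2 ≤ n → q ≡ p ^ n → q ≡ r * r → p ∣ r → 3 ≤ r →
    (∃ λ d → Good p q r d)
    × (r % 3 ≡ 0 ⊎ r % 3 ≡ 1 → Good p q r (q ∸ r + 1))
    × (r % 9 ≡ 2 ⊎ r % 9 ≡ 8 → Good p q r ((q + 2) / 3))
    × (r % 9 ≡ 5 ⊎ r % 9 ≡ 8 → Good p q r ((2 * q + 1) / 3))
theorem-for-squares {p} {r = r} 2≤p 2≤n r²≡pⁿ refl p∣r 3≤r = example , good-A , good-B , good-C
  where
  good-A = case-A 2≤p 2≤n r²≡pⁿ p∣r 3≤r
  good-B = case-B 2≤p 2≤n r²≡pⁿ p∣r 3≤r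
  good-C = case-C 2≤p 2≤n r²≡pⁿ p∣r 3≤r
  example : ∃ λ d → Good p (r * r) r d
  example = [ (λ h → _ , good-A h) , [ (λ h → _ , good-B h) , (λ h → _ , good-C h) ]′ ]′ (residue-cases r)

3≤-of-square>4 : ∀ r → 4 < r * r → 3 ≤ r
3≤-of-square>4 0 ()
3≤-of-square>4 1 (s≤s ())
3≤-of-square>4 2 (s≤s (s≤s (s≤s (s≤s ()))))
3≤-of-square>4 (suc (suc (suc r))) _ = s≤s (s≤s (s≤s z≤n))

lemma4p2 : (p s : ℕ) → Prime p → 1 ≤ s → 4 < p ^ (2 ^ s) →
    (∃ λ d → Good p (p ^ (2 ^ s)) (p ^ (2 ^ (s ∸ 1))) d)
    × ((p ^ (2 ^ (s ∸ 1))) % 3 ≡ 0 ⊎ (p ^ (2 ^ (s ∸ 1))) % 3 ≡ 1 →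
        Good p (p ^ (2 ^ s)) (p ^ (2 ^ (s ∸ 1))) (p ^ (2 ^ s) ∸ p ^ (2 ^ (s ∸ 1)) + 1))
    × ((p ^ (2 ^ (s ∸ 1))) % 9 ≡ 2 ⊎ (p ^ (2 ^ (s ∸ 1))) % 9 ≡ 8 →
        Good p (p ^ (2 ^ s)) (p ^ (2 ^ (s ∸ 1))) ((p ^ (2 ^ s) + 2) / 3))
    × ((p ^ (2 ^ (s ∸ 1))) % 9 ≡ 5 ⊎ (p ^ (2 ^ (s ∸ 1))) % 9 ≡ 8 →
        Good p (p ^ (2 ^ s)) (p ^ (2 ^ (s ∸ 1))) ((2 * p ^ (2 ^ s) + 1) / 3))
lemma4p2 p zero _ () _
lemma4p2 p (suc t) p-prime _ 4<q =
  theorem-for-squares 2≤p 2≤n refl q≡r² p∣r (3≤-of-square>4 r (subst (4 <_) q≡r² 4<q))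
  where
  r = p ^ (2 ^ t)
  2≤p : 2 ≤ p
  2≤p = nonTrivial⇒n>1 p {{prime⇒nonTrivial p-prime}}
  2≤n : 2 ≤ 2 ^ suc t
  2≤n = *-monoʳ-≤ 2 (m^n>0 2 t)
  -- q = p ^ (2 ^ t + 2 ^ t) = r * r
  q≡r² : p ^ (2 ^ suc t) ≡ r * r
  q≡r² = trans (^-distribˡ-+-* p (2 ^ t) (2 ^ t + 0)) (cong (λ e → r * p ^ e) (+-identityʳ (2 ^ t)))
  p∣r : p ∣ r
  p∣r with 2 ^ t | m^n>0 2 t
  ... | suc k | _ = m∣m*n (p ^ k)
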